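{- Let $S \subseteq \mathbb{Z}$ be a finite set, and let $(t_i)_{i \ge 0}$ be the sequence produced by the greedy packing algorithm for $S$. Then for all $i \ge 0$, $t_i \le i\,|\mathrm{diff}(S)|$.
   Context: For sets $X, Y \subseteq \mathbb{Z}$, $X + Y = \{x + y : x \in X, y \in Y\}$. The difference set of $S$ is $\mathrm{diff}(S) = \{s - t : s, t \in S,\ s \ge t\}$. The greedy packing algorithm for $S$: set $A_{ -1} = \emptyset$, and for each $i \ge 0$ let $t_i = \min\{x \in \mathbb{Z} : x \ge 0,\ x \notin A_{i-1} + \mathrm{diff}(S)\}$ and $A_i = A_{i-1} \cup \{t_i\}$. -}

module Defs where

open import Data.Nat using (ℕ; _<_)
open import Data.Integer as ℤ using (ℤ; +_; _-_; _≟_; _≤?_)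
open import Data.List using (List; deduplicate; filter; cartesianProductWith; length)
open import Data.List.Membership.Propositional using (_∈_)
open import Data.Product using (Σ; _×_; ∃-syntax)
open import Relation.Binary.PropositionalEquality using (_≡_)
open import Relation.Nullary using (¬_)

-- A finite set S ⊆ ℤ is represented by a list (duplicates irrelevant).

diffList : List ℤ → List ℤ
diffList S = deduplicate _≟_ (filter (λ d → + 0 ≤? d) (cartesianProductWith _-_ S S))

diffCard : List ℤ → ℕ
diffCard S = length (diffList S)

-- x ∈ A_{i-1} + diff(S), where A_{i-1} = { t j : j < i }
Blocked : List ℤ → (ℕ → ℕ) → ℕ → ℕ → Set
Blocked S t i x =
  ∃[ j ] ∃[ s ] ∃[ u ] (j < i × s ∈ S × u ∈ S × u ℤ.≤ s × + x ≡ (+ t j) ℤ.+ (s - u))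

IsGreedy : List ℤ → (ℕ → ℕ) → Set
IsGreedy S t = ∀ i → ¬ Blocked S t i (t i) × (∀ x → ¬ Blocked S t i x → t i Data.Nat.≤ x)

-- The blocked set A_{i-1} + diff(S) is the union of the i translates t_j + diff(S), j < i,
-- so it has at most i |diff(S)| elements. Among the i |diff(S)| + 1 numbers 0, 1, …, i |diff(S)|
-- one therefore escapes it, and t_i, being the least unblocked number, is at most that one.
module Submission where

open import Defs
open import Data.Nat using (ℕ; zero; suc; _≤_; _*_; s≤s; s≤s⁻¹)
import Data.Nat as ℕ
open import Data.Nat.Properties using (n<1+n; ≤-trans; ≤-reflexive; ≤∧≢⇒<)
open import Data.Integer as ℤ using (ℤ; +_; _-_; _≟_; _≤?_)
open import Data.Integer.Properties using (+-injective; i≤j⇒0≤j-i)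
open import Data.List using (List; []; _++_; map; length; lookup)
open import Data.List.Properties using (length-map; length-++)
open import Data.List.Membership.Propositional using (_∈_; _∉_)
open import Data.List.Membership.Propositional.Properties
  using (∈-map⁺; ∈-++⁺ˡ; ∈-++⁺ʳ; ∈-filter⁺; ∈-deduplicate⁺; ∈-cartesianProductWith⁺)
open import Data.List.Relation.Unary.Any using (index)
open import Data.List.Relation.Unary.Any.Properties using (lookup-index)
open import Data.Fin using (Fin; toℕ)
open import Data.Fin.Properties using (pigeonhole; ¬∀⟶∃¬; toℕ-injective; toℕ<n)
  renaming (<-irrefl to <-irreflᶠ)
open import Data.Product using (_×_; ∃-syntax; _,_; proj₂)
open import Function using (_∘_)
open import Function.Definitions using (Injective)
open import Relation.Binary.Definitions using (DecidableEquality)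
open import Relation.Binary.PropositionalEquality using (_≡_; refl; sym; trans; cong; cong₂; subst)
open import Relation.Nullary using (¬_; yes; no)
import Data.List.Membership.DecPropositional as DecMembership

module _ {a} {A : Set a} (f : ℕ → A) (f-injective : Injective _≡_ _≡_ f) where

  ¬-initial-image-⊆ : (L : List A) → ¬ (∀ (k : Fin (suc (length L))) → f (toℕ k) ∈ L)
  ¬-initial-image-⊆ L f[k]∈L
    with k , l , k<l , same-index ← pigeonhole (n<1+n (length L)) (index ∘ f[k]∈L)
    = <-irreflᶠ (toℕ-injective (f-injective f[k]≡f[l])) k<l
    where
    f[k]≡f[l] : f (toℕ k) ≡ f (toℕ l)
    f[k]≡f[l] = trans (lookup-index (f[k]∈L k))
                  (trans (cong (lookup L) same-index) (sym (lookup-index (f[k]∈L l))))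

  ∃-image-∉-≤-length : DecidableEquality A → (L : List A) → ∃[ x ] (x ≤ length L × f x ∉ L)
  ∃-image-∉-≤-length _≟ᴬ_ L
    with k , f[k]∉L ← ¬∀⟶∃¬ _ (λ k → f (toℕ k) ∈ L) (λ k → DecMembership._∈?_ _≟ᴬ_ (f (toℕ k)) L)
                           (¬-initial-image-⊆ L)
    = toℕ k , s≤s⁻¹ (toℕ<n k) , f[k]∉L

∈-diffList : ∀ S {s u} → s ∈ S → u ∈ S → u ℤ.≤ s → s - u ∈ diffList S
∈-diffList S s∈S u∈S u≤s = ∈-deduplicate⁺ _≟_
  (∈-filter⁺ (+ 0 ≤?_) (∈-cartesianProductWith⁺ _-_ s∈S u∈S) (i≤j⇒0≤j-i u≤s))

-- A_{i-1} + diff(S), with repetitions.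
blockedList : List ℤ → (ℕ → ℕ) → ℕ → List ℤ
blockedList S t zero    = []
blockedList S t (suc i) = map (ℤ._+_ (+ t i)) (diffList S) ++ blockedList S t i

length-blockedList : ∀ S t i → length (blockedList S t i) ≡ i * diffCard S
length-blockedList S t zero    = refl
length-blockedList S t (suc i) = trans (length-++ (map (ℤ._+_ (+ t i)) (diffList S)))
  (cong₂ ℕ._+_ (length-map (ℤ._+_ (+ t i)) (diffList S)) (length-blockedList S t i))

Blocked⇒∈blockedList : ∀ S t i x → Blocked S t i x → + x ∈ blockedList S t i
Blocked⇒∈blockedList S t (suc i) x (j , s , u , s≤s j≤i , s∈S , u∈S , u≤s , x≡tj+s-u)
  with j ℕ.≟ i
... | yes refl = ∈-++⁺ˡ (subst (_∈ _) (sym x≡tj+s-u) (∈-map⁺ (ℤ._+_ (+ t j)) (∈-diffList S s∈S u∈S u≤s)))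
... | no  j≢i  = ∈-++⁺ʳ (map (ℤ._+_ (+ t i)) (diffList S))
  (Blocked⇒∈blockedList S t i x (j , s , u , ≤∧≢⇒< j≤i j≢i , s∈S , u∈S , u≤s , x≡tj+s-u))

lemma3p1 : (S : List ℤ) (t : ℕ → ℕ) → IsGreedy S t → (i : ℕ) → t i ≤ i * diffCard S
lemma3p1 S t greedy i
  with x , x≤length , x∉blocked ← ∃-image-∉-≤-length +_ +-injective _≟_ (blockedList S t i)
  = ≤-trans t[i]≤x (≤-trans x≤length (≤-reflexive (length-blockedList S t i)))
  where
  t[i]≤x : t i ≤ x
  t[i]≤x = proj₂ (greedy i) x (x∉blocked ∘ Blocked⇒∈blockedList S t i x)
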